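{- Let $A$ and $B$ be $0,1$-matrices. Suppose that there exist two families of $0,1$-matrices, $\mathcal{M}=\{M_1,\ldots,M_s\}$ (of the size of $A$) and $\mathcal{N}=\{N_1,\ldots,N_s\}$ (of the size of $B$), such that every $\lceil s/2\rceil$ matrices of $\mathcal{M}$ cover $A$ and every $\lceil s/2\rceil$ matrices of $\mathcal{N}$ cover $B$. Then $\mathrm{R}_{\mathbb{B}}(A\otimes B)\le\sum_{t=1}^s \mathrm{R}_{\mathbb{B}}(M_t)\cdot\mathrm{R}_{\mathbb{B}}(N_t)$. In particular, if every $\lceil s/2\rceil$ matrices of $\mathcal{M}$ cover $A$, then $\mathrm{R}_{\mathbb{B}}(A\otimes A)\le \sum_{t=1}^s\mathrm{R}_{\mathbb{B}}(M_t)^2$.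
   Context: The Boolean rank $\mathrm{R}_{\mathbb{B}}(A)$ of a $0,1$-matrix $A$ is the smallest number of all-ones combinatorial rectangles (sets of the form $X\times Y$, $X$ a set of rows, $Y$ a set of columns, all entries of $A$ there equal to $1$) needed to cover all $1$-entries of $A$. A collection of $0,1$-matrices of the same size as $A$ covers $A$ if for every $i,j$: $A_{i,j}=1$ iff at least one matrix of the collection has a $1$ in entry $(i,j)$. The Kronecker product $A\otimes B$ is the block matrix whose $(i,j)$-th block is $A_{i,j}\cdot B$. -}

module Defs where

open import Data.Nat using (ℕ; zero; suc; _+_; _*_)
open import Data.Fin using (Fin; zero; suc; remQuot)
open import Data.Fin.Subset using (Subset; _∈_)
open import Data.Bool using (Bool; true; false; _∧_)
open import Data.Product using (Σ; _×_; _,_; proj₁; proj₂; ∃-syntax)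
open import Relation.Binary.PropositionalEquality using (_≡_)
open import Data.Nat using (_≤_)

Matrix : ℕ → ℕ → Set
Matrix m n = Fin m → Fin n → Bool

Rect : ℕ → ℕ → Set
Rect m n = (Fin m → Bool) × (Fin n → Bool)

AllOnes : ∀ {m n} → Matrix m n → Rect m n → Set
AllOnes A (X , Y) = ∀ i j → X i ≡ true → Y j ≡ true → A i j ≡ true

RectCover : ∀ {m n} → Matrix m n → ℕ → Set
RectCover {m} {n} A r =
  Σ (Fin r → Rect m n) λ R →
    (∀ k → AllOnes A (R k)) ×
    (∀ i j → A i j ≡ true →
       ∃[ k ] (proj₁ (R k) i ≡ true × proj₂ (R k) j ≡ true))

IsBoolRank : ∀ {m n} → Matrix m n → ℕ → Set
IsBoolRank A r = RectCover A r × (∀ k → RectCover A k → r ≤ k)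

Covers : ∀ {m n s} → (Fin s → Matrix m n) → Subset s → Matrix m n → Set
Covers M S A = ∀ i j → (A i j ≡ true → ∃[ t ] (t ∈ S × M t i j ≡ true))
                     × (∃[ t ] (t ∈ S × M t i j ≡ true) → A i j ≡ true)

-- Kronecker product: the (i,j) block is A i j · B; row index of block row i,
-- inner row k is combine i k = i * p + k.
_⊗_ : ∀ {m n p q} → Matrix m n → Matrix p q → Matrix (m * p) (n * q)
_⊗_ {m} {n} {p} {q} A B x y =
  A (proj₁ (remQuot {m} p x)) (proj₁ (remQuot {n} q y))
  ∧ B (proj₂ (remQuot {m} p x)) (proj₂ (remQuot {n} q y))

sumFin : ∀ {s} → (Fin s → ℕ) → ℕ
sumFin {zero} f = 0
sumFin {suc s} f = f zero + sumFin (λ t → f (suc t))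

-- Every member of M lies below A, because each index belongs to some
-- ⌈s/2⌉-subset. Products of optimal rectangle covers of M t and N t give
-- rM t · rN t all-ones rectangles of A ⊗ B covering the 1-entries of M t ⊗ N t.
-- These families together cover A ⊗ B: for a 1-entry with A i j = B k l = 1,
-- the sets {t | M t i j = 1} and {t | N t k l = 1} meet every ⌈s/2⌉-subset,
-- so their complements have fewer than ⌈s/2⌉ elements each; two such
-- complements cannot exhaust all s indices, so some t has M t i j = N t k l = 1.
module Submission where

open import Defs
open import Data.Bool using (Bool; true; _∧_)
open import Data.Bool.Properties using (∧-conicalˡ; ∧-conicalʳ)
open import Data.Fin
  using (Fin; zero; suc; quotient; remainder; remQuot; combine; splitAt; _↑ˡ_; _↑ʳ_)
open import Data.Fin.Properties using (remQuot-combine; splitAt-↑ˡ; splitAt-↑ʳ)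
open import Data.Fin.Subset
  using (Subset; ∣_∣; _∈_; _⊆_; ⊤; ⊥; ∁; _∪_; _∩_; Nonempty; inside; outside)
open import Data.Fin.Subset.Properties
  using ( ⊥⊆; ∣⊥∣≡0; ∣⊤∣≡n; ∈⊤; ⊆-refl; out⊆; in⊆in; p⊆q⇒∣p∣≤∣q∣; _∈?_
        ; x∈∁p⇒x∉p; x∉p⇒x∈∁p; x∈p∪q⁺; x∈p∩q⁺; x∈p∩q⁻; nonempty? )
open import Data.Nat
  using (ℕ; zero; suc; _+_; _*_; _≤_; _<_; z≤n; s≤s; s≤s⁻¹; _≤?_; ⌈_/2⌉)
open import Data.Nat.Properties
  using ( ≤-trans; ≤-reflexive; ≤-antisym; ≰⇒>; <-irrefl; n≤1+n; +-suc
        ; +-mono-≤; +-monoʳ-≤; ⌈n/2⌉-mono; ⌈n/2⌉≤n; ⌊n/2⌋+⌈n/2⌉≡n; module ≤-Reasoning )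
open import Data.Product using (Σ; _×_; _,_; proj₁; proj₂; ∃-syntax)
open import Data.Sum using (_⊎_; inj₁; inj₂)
open import Data.Vec using (_∷_; []; tabulate; here; there)
open import Data.Vec.Properties using ([]=⇒lookup; lookup⇒[]=; lookup∘tabulate)
open import Function using (_∘_)
open import Level using (0ℓ)
open import Relation.Binary.Core using (REL; _⇒_)
open import Relation.Binary.PropositionalEquality
  using (_≡_; refl; sym; trans; cong; cong₂; subst)
open import Relation.Nullary using (yes; no; contradiction)

private
  variable
    m n p q r s k : ℕ

∧-true⁻ : ∀ {x y} → x ∧ y ≡ true → x ≡ true × y ≡ true
∧-true⁻ {x} {y} e = ∧-conicalˡ x y e , ∧-conicalʳ x y e

∧-true⁺ : ∀ {x y} → x ≡ true → y ≡ true → x ∧ y ≡ true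
∧-true⁺ = cong₂ _∧_

⌈n/2⌉+⌈n/2⌉≤1+n : ∀ n → ⌈ n /2⌉ + ⌈ n /2⌉ ≤ suc n
⌈n/2⌉+⌈n/2⌉≤1+n n = ≤-trans (+-monoʳ-≤ ⌈ n /2⌉ (⌈n/2⌉-mono (n≤1+n n)))
                            (≤-reflexive (⌊n/2⌋+⌈n/2⌉≡n (suc n)))

∈-tabulate⁺ : ∀ (f : Fin n → Bool) {x} → f x ≡ true → x ∈ tabulate f
∈-tabulate⁺ f {x} e = lookup⇒[]= x (tabulate f) (trans (lookup∘tabulate f x) e)

∈-tabulate⁻ : ∀ (f : Fin n → Bool) {x} → x ∈ tabulate f → f x ≡ true
∈-tabulate⁻ f {x} x∈ = trans (sym (lookup∘tabulate f x)) ([]=⇒lookup x∈)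

∣p∪q∣≤∣p∣+∣q∣ : ∀ (p q : Subset n) → ∣ p ∪ q ∣ ≤ ∣ p ∣ + ∣ q ∣
∣p∪q∣≤∣p∣+∣q∣ []            []            = z≤n
∣p∪q∣≤∣p∣+∣q∣ (outside ∷ p) (outside ∷ q) = ∣p∪q∣≤∣p∣+∣q∣ p q
∣p∪q∣≤∣p∣+∣q∣ (outside ∷ p) (inside ∷ q)  =
  ≤-trans (s≤s (∣p∪q∣≤∣p∣+∣q∣ p q)) (≤-reflexive (sym (+-suc ∣ p ∣ ∣ q ∣)))
∣p∪q∣≤∣p∣+∣q∣ (inside ∷ p)  (outside ∷ q) = s≤s (∣p∪q∣≤∣p∣+∣q∣ p q)
∣p∪q∣≤∣p∣+∣q∣ (inside ∷ p)  (inside ∷ q)  =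
  s≤s (≤-trans (∣p∪q∣≤∣p∣+∣q∣ p q) (+-monoʳ-≤ ∣ p ∣ (n≤1+n ∣ q ∣)))

∃-⊆-∣∣≡ : ∀ (p : Subset n) → k ≤ ∣ p ∣ → ∃[ q ] (q ⊆ p × ∣ q ∣ ≡ k)
∃-⊆-∣∣≡ []            z≤n = [] , ⊆-refl , refl
∃-⊆-∣∣≡ (outside ∷ p) k≤ with ∃-⊆-∣∣≡ p k≤
... | q , q⊆p , ∣q∣≡k = outside ∷ q , out⊆ q⊆p , ∣q∣≡k
∃-⊆-∣∣≡ {suc n} (inside ∷ p) z≤n = ⊥ , ⊥⊆ , ∣⊥∣≡0 (suc n)
∃-⊆-∣∣≡ (inside ∷ p)  (s≤s k≤) with ∃-⊆-∣∣≡ p k≤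
... | q , q⊆p , ∣q∣≡k = inside ∷ q , in⊆in q⊆p , cong suc ∣q∣≡k

∃-∋-∣∣≡ : ∀ (x : Fin n) → 0 < k → k ≤ n → ∃[ q ] (x ∈ q × ∣ q ∣ ≡ k)
∃-∋-∣∣≡ {suc n} {suc k} zero _ (s≤s k≤n)
  with ∃-⊆-∣∣≡ (⊤ {n}) (≤-trans k≤n (≤-reflexive (sym (∣⊤∣≡n n))))
... | q , _ , ∣q∣≡k = inside ∷ q , here , cong suc ∣q∣≡k
∃-∋-∣∣≡ {suc n} {k} (suc x) 0<k k≤1+n with k ≤? n
... | yes k≤n = let q , x∈q , ∣q∣≡k = ∃-∋-∣∣≡ x 0<k k≤n in outside ∷ q , there x∈q , ∣q∣≡k
... | no  k≰n = ⊤ , ∈⊤ , trans (∣⊤∣≡n (suc n)) (≤-antisym (≰⇒> k≰n) k≤1+n)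

Hits : ℕ → Subset n → Set
Hits k p = ∀ S → ∣ S ∣ ≡ k → Nonempty (S ∩ p)

hits⇒∣∁∣< : ∀ (p : Subset n) → Hits k p → ∣ ∁ p ∣ < k
hits⇒∣∁∣< {k = k} p hits with k ≤? ∣ ∁ p ∣
... | no  k≰ = ≰⇒> k≰
... | yes k≤ with ∃-⊆-∣∣≡ (∁ p) k≤
...   | S , S⊆∁p , ∣S∣≡k with hits S ∣S∣≡k
...     | t , t∈S∩p = let t∈S , t∈p = x∈p∩q⁻ S p t∈S∩p in
                      contradiction t∈p (x∈∁p⇒x∉p (S⊆∁p t∈S))

half-hits-meet : ∀ (p q : Subset n) → Hits ⌈ n /2⌉ p → Hits ⌈ n /2⌉ q → Nonempty (p ∩ q)
half-hits-meet {n} p q hits-p hits-q with nonempty? (p ∩ q)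
... | yes p∩q≢∅ = p∩q≢∅
... | no  p∩q≡∅ = contradiction counting (<-irrefl refl)
  where
  ⊤⊆∁p∪∁q : ⊤ {n} ⊆ ∁ p ∪ ∁ q
  ⊤⊆∁p∪∁q {t} _ with t ∈? p
  ... | no  t∉p = x∈p∪q⁺ (inj₁ (x∉p⇒x∈∁p t∉p))
  ... | yes t∈p = x∈p∪q⁺ (inj₂ (x∉p⇒x∈∁p λ t∈q → p∩q≡∅ (t , x∈p∩q⁺ (t∈p , t∈q))))

  ∣∁p∣+∣∁q∣<n : ∣ ∁ p ∣ + ∣ ∁ q ∣ < n
  ∣∁p∣+∣∁q∣<n = s≤s⁻¹ (begin
    suc (suc (∣ ∁ p ∣ + ∣ ∁ q ∣)) ≡⟨ cong suc (+-suc ∣ ∁ p ∣ ∣ ∁ q ∣) ⟨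
    suc ∣ ∁ p ∣ + suc ∣ ∁ q ∣     ≤⟨ +-mono-≤ (hits⇒∣∁∣< p hits-p) (hits⇒∣∁∣< q hits-q) ⟩
    ⌈ n /2⌉ + ⌈ n /2⌉             ≤⟨ ⌈n/2⌉+⌈n/2⌉≤1+n n ⟩
    suc n                         ∎)
    where open ≤-Reasoning

  counting : n < n
  counting = begin-strict
    n                     ≡⟨ ∣⊤∣≡n n ⟨
    ∣ ⊤ {n} ∣             ≤⟨ p⊆q⇒∣p∣≤∣q∣ ⊤⊆∁p∪∁q ⟩
    ∣ ∁ p ∪ ∁ q ∣         ≤⟨ ∣p∪q∣≤∣p∣+∣q∣ (∁ p) (∁ q) ⟩
    ∣ ∁ p ∣ + ∣ ∁ q ∣     <⟨ ∣∁p∣+∣∁q∣<n ⟩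
    n                     ∎
    where open ≤-Reasoning

Ones : Matrix m n → REL (Fin m) (Fin n) 0ℓ
Ones A i j = A i j ≡ true

infix 4 _⊑_

_⊑_ : Matrix m n → Matrix m n → Set
A ⊑ B = Ones A ⇒ Ones B

-- RectCover A r is definitionally RectCoverOf A (Ones A) r.
RectCoverOf : Matrix m n → REL (Fin m) (Fin n) 0ℓ → ℕ → Set
RectCoverOf {m} {n} A P r =
  Σ (Fin r → Rect m n) λ R →
    (∀ k → AllOnes A (R k)) ×
    (∀ i j → P i j → ∃[ k ] (proj₁ (R k) i ≡ true × proj₂ (R k) j ≡ true))

rectCoverOf-⇒ : ∀ {A : Matrix m n} {P Q} → Q ⇒ P → RectCoverOf A P r → RectCoverOf A Q r
rectCoverOf-⇒ Q⇒P (R , allOnes , covered) = R , allOnes , λ i j → covered i j ∘ Q⇒P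

rectCoverOf-⊑ : ∀ {A B : Matrix m n} {P} → A ⊑ B → RectCoverOf A P r → RectCoverOf B P r
rectCoverOf-⊑ A⊑B (R , allOnes , covered) =
  R , (λ k i j i∈X j∈Y → A⊑B (allOnes k i j i∈X j∈Y)) , covered

rectCoverOf-⊎ : ∀ {A : Matrix m n} {P Q} → RectCoverOf A P r → RectCoverOf A Q s →
                RectCoverOf A (λ i j → P i j ⊎ Q i j) (r + s)
rectCoverOf-⊎ {r = r} {s = s} {A = A} (R₁ , allOnes₁ , covered₁) (R₂ , allOnes₂ , covered₂) =
  R , allOnes , covered
  where
  R′ : Fin r ⊎ Fin s → Rect _ _
  R′ (inj₁ k) = R₁ k
  R′ (inj₂ k) = R₂ k

  R : Fin (r + s) → Rect _ _
  R k = R′ (splitAt r k)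

  allOnes : ∀ k → AllOnes A (R k)
  allOnes k with splitAt r k
  ... | inj₁ k₁ = allOnes₁ k₁
  ... | inj₂ k₂ = allOnes₂ k₂

  covered : ∀ i j → _ ⊎ _ → ∃[ k ] (proj₁ (R k) i ≡ true × proj₂ (R k) j ≡ true)
  covered i j (inj₁ Pij) with covered₁ i j Pij
  ... | k , i∈X , j∈Y = k ↑ˡ s , subst (λ c → proj₁ (R′ c) i ≡ true × proj₂ (R′ c) j ≡ true)
                                       (sym (splitAt-↑ˡ r k s)) (i∈X , j∈Y)
  covered i j (inj₂ Qij) with covered₂ i j Qij
  ... | k , i∈X , j∈Y = r ↑ʳ k , subst (λ c → proj₁ (R′ c) i ≡ true × proj₂ (R′ c) j ≡ true)
                                       (sym (splitAt-↑ʳ r s k)) (i∈X , j∈Y)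

rectCoverOf-∃ : ∀ {A : Matrix m n} (P : Fin s → REL (Fin m) (Fin n) 0ℓ) (r : Fin s → ℕ) →
                (∀ t → RectCoverOf A (P t) (r t)) →
                RectCoverOf A (λ i j → ∃[ t ] P t i j) (sumFin r)
rectCoverOf-∃ {s = zero}  P r covers = (λ ()) , (λ ()) , λ { _ _ (() , _) }
rectCoverOf-∃ {s = suc s} P r covers =
  rectCoverOf-⇒ (λ { (zero , Pij) → inj₁ Pij ; (suc t , Pij) → inj₂ (t , Pij) })
    (rectCoverOf-⊎ (covers zero) (rectCoverOf-∃ (P ∘ suc) (r ∘ suc) (covers ∘ suc)))

ones-⊗⁻ : ∀ (A : Matrix m n) (B : Matrix p q) {x y} → Ones (A ⊗ B) x y →
          Ones A (quotient {m} p x) (quotient {n} q y) × Ones B (remainder {m} p x) (remainder {n} q y)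
ones-⊗⁻ A B = ∧-true⁻

⊗-mono : ∀ {A A′ : Matrix m n} {B B′ : Matrix p q} → A ⊑ A′ → B ⊑ B′ → A ⊗ B ⊑ A′ ⊗ B′
⊗-mono {A = A} {B = B} A⊑A′ B⊑B′ Aij∧Bkl =
  let Aij , Bkl = ones-⊗⁻ A B Aij∧Bkl in ∧-true⁺ (A⊑A′ Aij) (B⊑B′ Bkl)

_⊗ᵛ_ : (Fin m → Bool) → (Fin p → Bool) → Fin (m * p) → Bool
_⊗ᵛ_ {m} {p} u v x = u (quotient {m} p x) ∧ v (remainder {m} p x)

_⊗ᴿ_ : Rect m n → Rect p q → Rect (m * p) (n * q)
(X , Y) ⊗ᴿ (X′ , Y′) = X ⊗ᵛ X′ , Y ⊗ᵛ Y′

allOnes-⊗ : ∀ {A : Matrix m n} {B : Matrix p q} {R R′} →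
            AllOnes A R → AllOnes B R′ → AllOnes (A ⊗ B) (R ⊗ᴿ R′)
allOnes-⊗ onesA onesB x y x∈X y∈Y =
  let x∈X₁ , x∈X₂ = ∧-true⁻ x∈X ; y∈Y₁ , y∈Y₂ = ∧-true⁻ y∈Y in
  ∧-true⁺ (onesA _ _ x∈X₁ y∈Y₁) (onesB _ _ x∈X₂ y∈Y₂)

rectCover-⊗ : ∀ {A : Matrix m n} {B : Matrix p q} →
              RectCover A r → RectCover B s → RectCover (A ⊗ B) (r * s)
rectCover-⊗ {r = r} {s = s} {A = A} {B} (R₁ , allOnes₁ , covered₁) (R₂ , allOnes₂ , covered₂) =
  R , (λ k → allOnes-⊗ (allOnes₁ _) (allOnes₂ _)) , covered
  where
  R′ : Fin r × Fin s → Rect _ _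
  R′ (k₁ , k₂) = R₁ k₁ ⊗ᴿ R₂ k₂

  R : Fin (r * s) → Rect _ _
  R = R′ ∘ remQuot s

  covered : ∀ x y → Ones (A ⊗ B) x y → ∃[ k ] (proj₁ (R k) x ≡ true × proj₂ (R k) y ≡ true)
  covered x y ABxy with ones-⊗⁻ A B ABxy
  ... | Aij , Bkl with covered₁ _ _ Aij | covered₂ _ _ Bkl
  ...   | k₁ , i∈X₁ , j∈Y₁ | k₂ , i∈X₂ , j∈Y₂ =
    combine k₁ k₂ , subst (λ c → proj₁ (R′ c) x ≡ true × proj₂ (R′ c) y ≡ true)
                          (sym (remQuot-combine k₁ k₂))
                          (∧-true⁺ i∈X₁ i∈X₂ , ∧-true⁺ j∈Y₁ j∈Y₂)

EveryCovers : ℕ → (Fin s → Matrix m n) → Matrix m n → Set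
EveryCovers {s} k M A = ∀ (S : Subset s) → ∣ S ∣ ≡ k → Covers M S A

everyCovers⇒⊑ : ∀ {M : Fin s → Matrix m n} {A} →
                EveryCovers k M A → 0 < k → k ≤ s → ∀ t → M t ⊑ A
everyCovers⇒⊑ {M = M} covers 0<k k≤s t {i} {j} Mtij with ∃-∋-∣∣≡ t 0<k k≤s
... | S , t∈S , ∣S∣≡k = proj₂ (covers S ∣S∣≡k i j) (t , t∈S , Mtij)

everyCovers-half⇒⊑ : ∀ {M : Fin s → Matrix m n} {A} → EveryCovers ⌈ s /2⌉ M A → ∀ t → M t ⊑ A
everyCovers-half⇒⊑ {suc s} {M = M} covers = everyCovers⇒⊑ {M = M} covers (s≤s z≤n) (⌈n/2⌉≤n (suc s))

support : (Fin s → Matrix m n) → Fin m → Fin n → Subset s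
support M i j = tabulate λ t → M t i j

everyCovers⇒hits : ∀ {M : Fin s → Matrix m n} {A i j} →
                   EveryCovers k M A → Ones A i j → Hits k (support M i j)
everyCovers⇒hits {i = i} {j} covers Aij S ∣S∣≡k with proj₁ (covers S ∣S∣≡k i j) Aij
... | t , t∈S , Mtij = t , x∈p∩q⁺ (t∈S , ∈-tabulate⁺ _ Mtij)

ones-⊗-⊆-⋃ : ∀ {A : Matrix m n} {B : Matrix p q} {M N} →
             EveryCovers ⌈ s /2⌉ M A → EveryCovers ⌈ s /2⌉ N B →
             Ones (A ⊗ B) ⇒ λ x y → ∃[ t ] Ones (M t ⊗ N t) x y
ones-⊗-⊆-⋃ {A = A} {B} {M} {N} coversA coversB ABxy with ones-⊗⁻ A B ABxy
... | Aij , Bkl with half-hits-meet _ _ (everyCovers⇒hits {M = M} coversA Aij)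
                                       (everyCovers⇒hits {M = N} coversB Bkl)
...   | t , t∈∩ = let t∈p , t∈q = x∈p∩q⁻ _ _ t∈∩ in
                  t , ∧-true⁺ (∈-tabulate⁻ _ t∈p) (∈-tabulate⁻ _ t∈q)

rectCover-⊗-Σ : ∀ {A : Matrix m n} {B : Matrix p q} {M N} →
                EveryCovers ⌈ s /2⌉ M A → EveryCovers ⌈ s /2⌉ N B →
                (rM rN : Fin s → ℕ) →
                (∀ t → RectCover (M t) (rM t)) → (∀ t → RectCover (N t) (rN t)) →
                RectCover (A ⊗ B) (sumFin λ t → rM t * rN t)
rectCover-⊗-Σ {M = M} {N} coversA coversB rM rN coverM coverN =
  rectCoverOf-⇒ (ones-⊗-⊆-⋃ {M = M} {N} coversA coversB) (rectCoverOf-∃ _ _ λ t →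
    rectCoverOf-⊑ {A = M t ⊗ N t} (⊗-mono {A = M t} {B = N t} (M⊑A t) (N⊑B t))
                  (rectCover-⊗ (coverM t) (coverN t)))
  where
  M⊑A : ∀ t → M t ⊑ _
  M⊑A = everyCovers-half⇒⊑ {M = M} coversA

  N⊑B : ∀ t → N t ⊑ _
  N⊑B = everyCovers-half⇒⊑ {M = N} coversB

boolRank-⊗-≤ : ∀ {A : Matrix m n} {B : Matrix p q} {M N} →
               EveryCovers ⌈ s /2⌉ M A → EveryCovers ⌈ s /2⌉ N B →
               (rM rN : Fin s → ℕ) →
               (∀ t → IsBoolRank (M t) (rM t)) → (∀ t → IsBoolRank (N t) (rN t)) →
               ∀ r → IsBoolRank (A ⊗ B) r → r ≤ sumFin (λ t → rM t * rN t)
boolRank-⊗-≤ {M = M} {N} coversA coversB rM rN rankM rankN _ (_ , minimal) =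
  minimal _ (rectCover-⊗-Σ {M = M} {N} coversA coversB rM rN (proj₁ ∘ rankM) (proj₁ ∘ rankN))

corollary1 : (∀ {m n p q s} (A : Matrix m n) (B : Matrix p q)
    (M : Fin s → Matrix m n) (N : Fin s → Matrix p q) →
    (∀ (S : Subset s) → ∣ S ∣ ≡ ⌈ s /2⌉ → Covers M S A) →
    (∀ (S : Subset s) → ∣ S ∣ ≡ ⌈ s /2⌉ → Covers N S B) →
    (rM rN : Fin s → ℕ) →
    (∀ t → IsBoolRank (M t) (rM t)) →
    (∀ t → IsBoolRank (N t) (rN t)) →
    (r : ℕ) → IsBoolRank (A ⊗ B) r →
    r ≤ sumFin (λ t → rM t * rN t))
    ×
    (∀ {m n s} (A : Matrix m n) (M : Fin s → Matrix m n) →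
    (∀ (S : Subset s) → ∣ S ∣ ≡ ⌈ s /2⌉ → Covers M S A) →
    (rM : Fin s → ℕ) →
    (∀ t → IsBoolRank (M t) (rM t)) →
    (r : ℕ) → IsBoolRank (A ⊗ A) r →
    r ≤ sumFin (λ t → rM t * rM t))
corollary1 =
  (λ A B M N → boolRank-⊗-≤ {A = A} {B} {M} {N}) ,
  (λ A M covers rM rankM → boolRank-⊗-≤ {A = A} {A} {M} {M} covers covers rM rM rankM rankM)
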